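{- Let $a\ge b\ge 2$ be integers, $n=a+b+1$, and let $I=i_1\cdots i_z\in\mathcal W_>$ with $q-p\ge 1$ (where $p,q$ are computed for $I$). For $1\le r\le q-p$ let $H_r=i_{p+r}i_{p+r-1}\cdots i_1\,i_{p+r+1}\cdots i_z$. If $D_{H_r}<0$ for some $1\le r\le q-p$, then either $r=q-p$, or $I\in\mathcal A$ and $r=1$.
   Context: A composition $I=i_1\cdots i_z\vDash n$ is a sequence of positive integers with sum $n$; $\overline I=i_z\cdots i_1$; $|i_1\cdots i_k|=i_1+\dots+i_k$. $w_I=i_1(i_2-1)\cdots(i_z-1)$. $\Theta_I^+(x)=\min\{|i_1\cdots i_k|:0\le k\le z,\ |i_1\cdots i_k|\ge x\}-x$; $\Theta_I^-(x)=x-\max\{|i_1\cdots i_k|:0\le k\le z,\ |i_1\cdots i_k|\le x\}$. $e_2(x_1,\dots,x_m)=\sum_{i<j}x_ix_j$. For any composition $J=j_1\cdots j_y$ of $n$, integers $p,s,q,t$ (depending on $J$) are defined by $b+1=j_1+\dots+j_{p-1}+s=j_2+\dots+j_q+t$, $1\le p,q\le y$, $1\le s\le j_p$, $1\le t\le j_{q+1}$, with $j_{y+1}=j_1$; $\Delta_J(b+1)=s(j_p-s-j_1)$ if $j_1\le j_p-s$, else $e_2(j_p-s,j_{p+1},\dots,j_q,t)$. $\varphi$: write $J=PQ$ with $Q$ the shortest suffix with $|Q|\ge a$; $\varphi(J)=J$ if $Q=J$, else $\varphi(J)=j_1\,\overline{P\backslash j_1}\,Q$ ($P\backslash j_1$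 = $P$ without its first part). $D_J=\Theta_J^+(2)-\Theta^-_{\overline{\varphi(J)}}(a)+\Delta_J(b+1)$. $\mathcal A=\{J\vDash n: w_J>0,\ \Theta^+_{\overline J}(a)=0\}$. $\mathcal W$ is the set of compositions of $n$ with all parts $\ge 2$, and $\mathcal W_>=\{J\in\mathcal W:j_1>\Theta^-_{\overline J}(a)\}$. -}

module Defs where

open import Data.Nat using (ℕ; zero; suc; _+_; _*_; _∸_; _≤_; _<_; _≤?_; _⊔_; _⊓_)
open import Data.Nat.ListAction using (sum; product)
open import Data.Integer as ℤ using (ℤ) renaming (+_ to ⁺_)
open import Data.List using (List; []; _∷_; _++_; [_]; map; foldr; filter; reverse; take; drop)
open import Data.List.Relation.Unary.All using (All)
open import Data.Product using (_×_; _,_; proj₁; proj₂)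
open import Data.Bool using (if_then_else_)
open import Relation.Nullary.Decidable using (⌊_⌋)
open import Relation.Binary.PropositionalEquality using (_≡_)

IsComposition : ℕ → List ℕ → Set
IsComposition n I = All (1 ≤_) I × sum I ≡ n

prefixSums : List ℕ → List ℕ
prefixSums []       = 0 ∷ []
prefixSums (x ∷ xs) = 0 ∷ map (λ k → x + k) (prefixSums xs)

-- minimum of a list (default 0 for the empty list; never used on [] below)
minL : List ℕ → ℕ
minL []       = 0
minL (x ∷ xs) = foldr _⊓_ x xs

maxL : List ℕ → ℕ
maxL = foldr _⊔_ 0

Θ⁺ : List ℕ → ℕ → ℕ
Θ⁺ I x = minL (filter (λ s → x ≤? s) (prefixSums I)) ∸ x

Θ⁻ : List ℕ → ℕ → ℕ
Θ⁻ I x = x ∸ maxL (filter (λ s → s ≤? x) (prefixSums I))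

w : List ℕ → ℕ
w []       = 1
w (i ∷ is) = i * product (map (λ k → k ∸ 1) is)

e₂ : List ℕ → ℕ
e₂ []       = 0
e₂ (x ∷ xs) = x * sum xs + e₂ xs

-- 1-based lookup (default 0 out of range)
nth : List ℕ → ℕ → ℕ
nth []       _             = 0
nth (x ∷ xs) zero          = 0
nth (x ∷ xs) (suc zero)    = x
nth (x ∷ xs) (suc (suc k)) = nth xs (suc k)

head0 : List ℕ → ℕ
head0 []      = 0
head0 (x ∷ _) = x

tail0 : List ℕ → List ℕ
tail0 []       = []
tail0 (_ ∷ xs) = xs

-- locate m J = (p , s) with m = j₁+⋯+j_{p-1}+s, 1 ≤ s ≤ j_p (for 1 ≤ m ≤ |J|)
locate : ℕ → List ℕ → ℕ × ℕ
locate m []       = 0 , 0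
locate m (j ∷ js) =
  if ⌊ m ≤? j ⌋ then (1 , m)
  else (let r = locate (m ∸ j) js in suc (proj₁ r) , proj₂ r)

pOf sOf qOf tOf : ℕ → List ℕ → ℕ
pOf b J = proj₁ (locate (suc b) J)
sOf b J = proj₂ (locate (suc b) J)
-- b+1 = j₂+⋯+j_q + t with 1 ≤ t ≤ j_{q+1}, j_{y+1} = j₁ :
-- locate in the cyclic shift j₂ ⋯ j_y j₁ ; index k there is part j_{k+1}, so q = k
qOf b J = proj₁ (locate (suc b) (tail0 J ++ [ head0 J ]))
tOf b J = proj₂ (locate (suc b) (tail0 J ++ [ head0 J ]))

Δ : ℕ → List ℕ → ℕ
Δ b J =
  let p = pOf b J ; s = sOf b J ; q = qOf b J ; t = tOf b J
      jp = nth J p ; j1 = head0 J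
  in if ⌊ j1 ≤? jp ∸ s ⌋
     then s * (jp ∸ s ∸ j1)
     else e₂ ((jp ∸ s) ∷ (take (q ∸ p) (drop p J) ++ [ t ]))

-- on the reversed list R = reverse J, split off the shortest prefix with sum ≥ a
-- (i.e. the reverse of the shortest suffix Q of J with |Q| ≥ a), returning (rev Q , rev P)
splitRev : ℕ → List ℕ → List ℕ × List ℕ
splitRev a []       = [] , []
splitRev a (x ∷ xs) =
  if ⌊ a ≤? x ⌋ then (x ∷ [] , xs)
  else (let r = splitRev (a ∸ x) xs in x ∷ proj₁ r , proj₂ r)

sufQ prefP : ℕ → List ℕ → List ℕ
sufQ  a J = reverse (proj₁ (splitRev a (reverse J)))
prefP a J = reverse (proj₂ (splitRev a (reverse J)))

φ : ℕ → List ℕ → List ℕ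
φ a J with prefP a J
... | []      = J
... | j ∷ P'  = j ∷ (reverse P' ++ sufQ a J)

D : ℕ → ℕ → List ℕ → ℤ
D a b J = (⁺ Θ⁺ J 2 ℤ.- ⁺ Θ⁻ (reverse (φ a J)) a) ℤ.+ ⁺ Δ b J

In𝒜 : ℕ → List ℕ → Set
In𝒜 a J = 0 < w J × Θ⁺ (reverse J) a ≡ 0

In𝒲 : ℕ → List ℕ → Set
In𝒲 n J = All (2 ≤_) J × sum J ≡ n

In𝒲> : ℕ → ℕ → List ℕ → Set
In𝒲> n a J = In𝒲 n J × Θ⁻ (reverse J) a < head0 J

H : ℕ → ℕ → List ℕ → List ℕ
H b r I = reverse (take (pOf b I + r) I) ++ drop (pOf b I + r) I

-- Write I = x M c T with c = i_{p+r}, so that H_r = c M̄ x T.  As all parts are at least 2,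
-- the prefix x M (which reaches past position b+1) has sum at least b + 1 + 2(r − 1), while
-- for r < q − p the prefix M c of the rotation i₂ ⋯ i_z i₁ is followed by a further part
-- before reaching b+1, so |M| + c + 2 ≤ b.  If |x M| = b + 1, then r = 1 and the suffix c T
-- has sum a, i.e. I ∈ 𝒜.  Otherwise position b+1 of H_r lies s ≥ 3 places into x and x
-- extends c + d (d ≥ 1) places beyond it, so Δ is s·d; also Θ⁺_{H_r}(2) = c − 2, and since
-- φ(H_r) ends with T and |T| < a, Θ⁻ ≤ a − |T| = c + d ≤ (c − 2) + s·d, whence D_{H_r} ≥ 0.

module Submission where

open import Defs
open import Data.Nat
open import Data.Nat.Properties
open import Algebra.Properties.CommutativeSemigroup +-commutativeSemigroup using (x∙yz≈y∙xz)
open import Data.Integer as ℤ using () renaming (+_ to ⁺_; _<_ to _<ℤ_)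
import Data.Integer.Properties as ℤ
open import Data.Integer.Tactic.RingSolver using () renaming (solve-∀ to ℤ-solve-∀)
open import Data.Nat.Tactic.RingSolver using (solve-∀)
open import Data.Nat.ListAction using (sum; product)
open import Data.Nat.ListAction.Properties using (sum-++; sum-↭)
open import Data.List using (List; []; _∷_; _++_; [_]; map; foldr; filter; reverse; take; drop; length)
open import Data.List.Properties using (++-assoc; length-++; reverse-++; unfold-reverse; reverse-involutive)
open import Data.List.Relation.Unary.All as All using (All; []; _∷_)
import Data.List.Relation.Unary.All.Properties as AllP
open import Data.List.Relation.Binary.Permutation.Propositional.Properties using (↭-reverse)
open import Data.Product using (_×_; _,_; proj₁; proj₂; ∃-syntax)
open import Data.Sum using (_⊎_; inj₁; inj₂)
open import Data.List.Relation.Unary.Any using (here; there)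
open import Data.List.Membership.Propositional using (_∈_)
open import Data.List.Membership.Propositional.Properties using (∈-map⁺; ∈-filter⁺)
open import Data.Bool using (true)
open import Relation.Nullary using (yes; no; contradiction)
open import Function using (_∘_)
open import Relation.Binary.PropositionalEquality hiding ([_]; J)

sum-reverse : ∀ L → sum (reverse L) ≡ sum L
sum-reverse L = sum-↭ (↭-reverse L)

2*length≤sum : ∀ {L} → All (2 ≤_) L → 2 * length L ≤ sum L
2*length≤sum []                   = z≤n
2*length≤sum {x ∷ L} (2≤x ∷ 2≤L) = begin
  2 * suc (length L)  ≡⟨ *-suc 2 (length L) ⟩
  2 + 2 * length L    ≤⟨ +-mono-≤ 2≤x (2*length≤sum 2≤L) ⟩
  x + sum L           ∎
  where open ≤-Reasoning

sum-∷-++-∷ : ∀ x M c T → sum (x ∷ M ++ c ∷ T) ≡ x + sum M + (c + sum T)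
sum-∷-++-∷ x M c T = trans (cong (x +_) (sum-++ M (c ∷ T))) (sym (+-assoc x (sum M) (c + sum T)))

split-∷ : ∀ n (L : List ℕ) → n < length L →
  ∃[ M ] ∃[ c ] ∃[ T ] (L ≡ M ++ c ∷ T × length M ≡ n)
split-∷ zero    (c ∷ T) _ = [] , c , T , refl , refl
split-∷ (suc n) (l ∷ L) (s≤s n<L) with split-∷ n L n<L
... | M , c , T , refl , refl = l ∷ M , c , T , refl , refl

take-++-∷ : ∀ (M : List ℕ) c T → take (suc (length M)) (M ++ c ∷ T) ≡ M ++ [ c ]
take-++-∷ []      c T = refl
take-++-∷ (m ∷ M) c T = cong (m ∷_) (take-++-∷ M c T)

drop-++-∷ : ∀ (M : List ℕ) c T → drop (suc (length M)) (M ++ c ∷ T) ≡ T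
drop-++-∷ []      c T = refl
drop-++-∷ (m ∷ M) c T = drop-++-∷ M c T

reverse-∷-++-∷ʳ : ∀ (x : ℕ) M c → reverse (x ∷ M ++ [ c ]) ≡ c ∷ reverse M ++ [ x ]
reverse-∷-++-∷ʳ x M c = begin
  reverse (x ∷ M ++ [ c ])        ≡⟨ unfold-reverse x (M ++ [ c ]) ⟩
  reverse (M ++ [ c ]) ++ [ x ]   ≡⟨ cong (_++ [ x ]) (reverse-++ M [ c ]) ⟩
  c ∷ reverse M ++ [ x ]          ∎
  where open ≡-Reasoning

++-∷ʳ-uncons : ∀ (T : List ℕ) x → ∃[ w ] ∃[ W ] (T ++ [ x ] ≡ w ∷ W)
++-∷ʳ-uncons []      x = x , [] , refl
++-∷ʳ-uncons (t ∷ T) x = t , T ++ [ x ] , refl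

locate₁≤length : ∀ m L → proj₁ (locate m L) ≤ length L
locate₁≤length m []       = z≤n
locate₁≤length m (j ∷ js) with m ≤? j
... | yes _ = s≤s z≤n
... | no  _ = s≤s (locate₁≤length (m ∸ j) js)

1≤locate₁ : ∀ m j js → 1 ≤ proj₁ (locate m (j ∷ js))
1≤locate₁ m j js with m ≤? j
... | yes _ = s≤s z≤n
... | no  _ = s≤s z≤n

locate-++-∷ : ∀ m L y R → sum L < m → m ≤ sum L + y →
  locate m (L ++ y ∷ R) ≡ (suc (length L) , m ∸ sum L)
locate-++-∷ m []      y R _   m≤y with m ≤? y
... | yes _   = refl
... | no  m≰y = contradiction m≤y m≰y
locate-++-∷ m (l ∷ L) y R L<m m≤ with m ≤? l
... | yes m≤l = contradiction (≤-trans m≤l (m≤m+n l (sum L))) (<⇒≱ L<m)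
... | no  _
  rewrite locate-++-∷ (m ∸ l) L y R
            (m+n≤o⇒m≤o∸n (suc (sum L)) (subst (λ k → suc k ≤ m) (+-comm l (sum L)) L<m))
            (m≤n+o⇒m∸n≤o m l (subst (m ≤_) (+-assoc l (sum L) y) m≤))
        | ∸-+-assoc m l (sum L)
  = refl

nth-++-∷ : ∀ L y R → nth (L ++ y ∷ R) (suc (length L)) ≡ y
nth-++-∷ []      y R = refl
nth-++-∷ (l ∷ L) y R = nth-++-∷ L y R

<locate₁⇒sum< : ∀ {m} K T → 1 ≤ m → length K < proj₁ (locate m (K ++ T)) → sum K < m
<locate₁⇒sum<     []      T 1≤m _ = 1≤m
<locate₁⇒sum< {m} (j ∷ K) T 1≤m K<p with m ≤? j
... | yes _   = contradiction K<p λ { (s≤s ()) }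
... | no  m≰j = subst (j + sum K <_) (m+[n∸m]≡n j≤m)
                  (+-monoʳ-< j (<locate₁⇒sum< K T (m<n⇒0<n∸m (≰⇒> m≰j)) (s≤s⁻¹ K<p)))
  where j≤m = <⇒≤ (≰⇒> m≰j)

locate₁≤⇒+2*≤sum : ∀ {m} K T → All (2 ≤_) K → m ≤ sum (K ++ T) →
  proj₁ (locate m (K ++ T)) ≤ length K →
  m + 2 * (length K ∸ proj₁ (locate m (K ++ T))) ≤ sum K
locate₁≤⇒+2*≤sum {m} []      []      _ m≤0 _   = ≤-trans (≤-reflexive (+-identityʳ m)) m≤0
locate₁≤⇒+2*≤sum {m} []      (t ∷ T) _ _   p≤0 = contradiction (≤-trans (1≤locate₁ m t T) p≤0) λ ()
locate₁≤⇒+2*≤sum {m} (j ∷ K) T (_ ∷ 2≤K) m≤ p≤ with m ≤? j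
... | yes m≤j = +-mono-≤ m≤j (2*length≤sum 2≤K)
... | no  m≰j = begin
  m + X                ≡⟨ cong (_+ X) (m+[n∸m]≡n j≤m) ⟨
  j + (m ∸ j) + X      ≡⟨ +-assoc j (m ∸ j) X ⟩
  j + ((m ∸ j) + X)    ≤⟨ +-monoʳ-≤ j (locate₁≤⇒+2*≤sum K T 2≤K (m≤n+o⇒m∸n≤o m j m≤) (s≤s⁻¹ p≤)) ⟩
  j + sum K            ∎
  where
  open ≤-Reasoning
  j≤m = <⇒≤ (≰⇒> m≰j)
  X = 2 * (length K ∸ proj₁ (locate (m ∸ j) (K ++ T)))

prefixSums-∷ : ∀ L → ∃[ ps ] (prefixSums L ≡ 0 ∷ ps)
prefixSums-∷ []      = [] , refl
prefixSums-∷ (x ∷ L) = _ , refl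

sum∈prefixSums : ∀ L Z → sum L ∈ prefixSums (L ++ Z)
sum∈prefixSums []      Z with prefixSums Z | prefixSums-∷ Z
... | .(0 ∷ ps) | ps , refl = here refl
sum∈prefixSums (l ∷ L) Z = there (∈-map⁺ (l +_) (sum∈prefixSums L Z))

foldr-⊓-≤ : ∀ {v} x L → v ∈ x ∷ L → foldr _⊓_ x L ≤ v
foldr-⊓-≤ x []      (here refl)         = ≤-refl
foldr-⊓-≤ x (y ∷ L) (here refl)         = ≤-trans (m⊓n≤n y _) (foldr-⊓-≤ x L (here refl))
foldr-⊓-≤ x (y ∷ L) (there (here refl)) = m⊓n≤m y _
foldr-⊓-≤ x (y ∷ L) (there (there v∈L)) = ≤-trans (m⊓n≤n y _) (foldr-⊓-≤ x L (there v∈L))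

minL-≤ : ∀ {v L} → v ∈ L → minL L ≤ v
minL-≤ {L = x ∷ L} = foldr-⊓-≤ x L

maxL-≥ : ∀ {v L} → v ∈ L → v ≤ maxL L
maxL-≥ {L = x ∷ L} (here refl) = m≤m⊔n x (maxL L)
maxL-≥ {L = x ∷ L} (there v∈L) = ≤-trans (maxL-≥ v∈L) (m≤n⊔m x (maxL L))

minL-∷ : ∀ {v} L → All (v ≤_) L → minL (v ∷ L) ≡ v
minL-∷ []      []          = refl
minL-∷ (y ∷ L) (v≤y ∷ v≤L) = trans (cong (y ⊓_) (minL-∷ L v≤L)) (m≥n⇒m⊓n≡n v≤y)

-- `filter` branches on `does (x ≤? v)`, which computes to `x ≤ᵇ v`, so that is what we match on.
minL-filter-≤ : ∀ {x v} L → x ≤ v → All (v ≤_) L → minL (filter (x ≤?_) (v ∷ L)) ≡ v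
minL-filter-≤ {x} {v} L x≤v v≤L with x ≤ᵇ v | ≤⇒≤ᵇ x≤v
... | true | _ = minL-∷ _ (AllP.filter⁺ (x ≤?_) v≤L)

Θ⁺-∷ : ∀ {x c} Y → 1 ≤ x → x ≤ c → Θ⁺ (c ∷ Y) x ≡ c ∸ x
Θ⁺-∷ {suc x} {c} Y _ x≤c with prefixSums Y | prefixSums-∷ Y
... | .(0 ∷ ps) | ps , refl =
  cong (_∸ suc x) (trans (minL-filter-≤ (map (c +_) ps) (≤-trans x≤c (m≤m+n c 0)) c+0≤ps)
                         (+-identityʳ c))
  where c+0≤ps = AllP.map⁺ (All.universal (λ k → +-monoʳ-≤ c z≤n) ps)

Θ⁺-++≡0 : ∀ {a} L Z → sum L ≡ a → Θ⁺ (L ++ Z) a ≡ 0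
Θ⁺-++≡0 {a} L Z refl =
  m≤n⇒m∸n≡0 (minL-≤ (∈-filter⁺ (a ≤?_) (sum∈prefixSums L Z) ≤-refl))

Θ⁻-++≤ : ∀ {a} L Z → sum L ≤ a → Θ⁻ (L ++ Z) a ≤ a ∸ sum L
Θ⁻-++≤ {a} L Z L≤a =
  ∸-monoʳ-≤ a (maxL-≥ (∈-filter⁺ (_≤? a) (sum∈prefixSums L Z) L≤a))

splitRev-++ : ∀ a L Z → sum L < a →
  proj₁ (splitRev a (L ++ Z)) ≡ L ++ proj₁ (splitRev (a ∸ sum L) Z)
splitRev-++ a []      Z _   = refl
splitRev-++ a (l ∷ L) Z L<a with a ≤? l
... | yes a≤l = contradiction (≤-trans a≤l (m≤m+n l (sum L))) (<⇒≱ L<a)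
... | no  _
  rewrite splitRev-++ (a ∸ l) L Z
            (m+n≤o⇒m≤o∸n (suc (sum L)) (subst (λ k → suc k ≤ a) (+-comm l (sum L)) L<a))
        | ∸-+-assoc a l (sum L)
  = refl

splitRev₁++splitRev₂≡id : ∀ a L → proj₁ (splitRev a L) ++ proj₂ (splitRev a L) ≡ L
splitRev₁++splitRev₂≡id a []       = refl
splitRev₁++splitRev₂≡id a (x ∷ xs) with a ≤? x
... | yes _ = refl
... | no  _ = cong (x ∷_) (splitRev₁++splitRev₂≡id (a ∸ x) xs)

reverse-φ : ∀ a J → ∃[ Z ] (reverse (φ a J) ≡ proj₁ (splitRev a (reverse J)) ++ Z)
reverse-φ a J with prefP a J
... | []     = proj₂ (splitRev a (reverse J)) , sym (splitRev₁++splitRev₂≡id a (reverse J))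
... | j ∷ P′ = P′ ++ [ j ] , (begin
  reverse (j ∷ reverse P′ ++ reverse Q′)      ≡⟨ unfold-reverse j (reverse P′ ++ reverse Q′) ⟩
  reverse (reverse P′ ++ reverse Q′) ++ [ j ] ≡⟨ cong (_++ [ j ]) (reverse-++ (reverse P′) (reverse Q′)) ⟩
  (reverse (reverse Q′) ++ reverse (reverse P′)) ++ [ j ]
    ≡⟨ cong₂ (λ u v → (u ++ v) ++ [ j ]) (reverse-involutive Q′) (reverse-involutive P′) ⟩
  (Q′ ++ P′) ++ [ j ]                           ≡⟨ ++-assoc Q′ P′ [ j ] ⟩
  Q′ ++ P′ ++ [ j ]                             ∎)
  where
  open ≡-Reasoning
  Q′ = proj₁ (splitRev a (reverse J))

Θ⁻-reverse-φ-++ : ∀ a K T → sum T < a → Θ⁻ (reverse (φ a (K ++ T))) a ≤ a ∸ sum T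
Θ⁻-reverse-φ-++ a K T T<a = subst (λ J → Θ⁻ J a ≤ a ∸ sum T) (sym reverse-φ≡) bound
  where
  open ≡-Reasoning
  Z  = proj₁ (reverse-φ a (K ++ T))
  S  = proj₁ (splitRev (a ∸ sum (reverse T)) (reverse K))
  rT<a = subst (_< a) (sym (sum-reverse T)) T<a
  reverse-φ≡ : reverse (φ a (K ++ T)) ≡ reverse T ++ S ++ Z
  reverse-φ≡ = begin
    reverse (φ a (K ++ T))                                ≡⟨ proj₂ (reverse-φ a (K ++ T)) ⟩
    proj₁ (splitRev a (reverse (K ++ T))) ++ Z            ≡⟨ cong (λ J → proj₁ (splitRev a J) ++ Z) (reverse-++ K T) ⟩
    proj₁ (splitRev a (reverse T ++ reverse K)) ++ Z      ≡⟨ cong (_++ Z) (splitRev-++ a (reverse T) (reverse K) rT<a) ⟩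
    (reverse T ++ S) ++ Z                                 ≡⟨ ++-assoc (reverse T) S Z ⟩
    reverse T ++ S ++ Z                                   ∎
  bound : Θ⁻ (reverse T ++ S ++ Z) a ≤ a ∸ sum T
  bound = subst (λ k → Θ⁻ (reverse T ++ S ++ Z) a ≤ a ∸ k) (sum-reverse T)
            (Θ⁻-++≤ (reverse T) (S ++ Z) (<⇒≤ rT<a))

Δ-short : ∀ b J → head0 J ≤ nth J (pOf b J) ∸ sOf b J →
  Δ b J ≡ sOf b J * (nth J (pOf b J) ∸ sOf b J ∸ head0 J)
Δ-short b J j₁≤ with head0 J ≤? nth J (pOf b J) ∸ sOf b J
... | yes _   = refl
... | no  j₁≰ = contradiction j₁≤ j₁≰

Δ-++-∷ : ∀ {b c y s d} L R → 1 ≤ s → c + sum L + s ≡ suc b → y ≡ s + (c + d) →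
  Δ b (c ∷ L ++ y ∷ R) ≡ s * d
Δ-++-∷ {b} {c} {y} {s} {d} L R 1≤s b+1≡ y≡ = begin
  Δ b J                                          ≡⟨ Δ-short b J c≤ ⟩
  sOf b J * (nth J (pOf b J) ∸ sOf b J ∸ c)      ≡⟨ cong₂ (λ s′ y′ → s′ * (y′ ∸ s′ ∸ c)) s≡ y′≡ ⟩
  s * (y ∸ s ∸ c)                                ≡⟨ cong (λ k → s * (k ∸ c)) y∸s≡ ⟩
  s * (c + d ∸ c)                                ≡⟨ cong (s *_) (m+n∸m≡n c d) ⟩
  s * d                                          ∎
  where
  open ≡-Reasoning
  J = c ∷ L ++ y ∷ R
  u = c + sum L
  locate≡ : locate (suc b) J ≡ (suc (suc (length L)) , suc b ∸ u)
  locate≡ = locate-++-∷ (suc b) (c ∷ L) y R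
    (subst (u <_) b+1≡ (subst (_≤ u + s) (+-comm u 1) (+-monoʳ-≤ u 1≤s)))
    (subst (_≤ u + y) b+1≡ (+-monoʳ-≤ u (subst (s ≤_) (sym y≡) (m≤m+n s (c + d)))))
  s≡ : sOf b J ≡ s
  s≡ = trans (cong proj₂ locate≡) (trans (cong (_∸ u) (sym b+1≡)) (m+n∸m≡n u s))
  y′≡ : nth J (pOf b J) ≡ y
  y′≡ = trans (cong (nth J ∘ proj₁) locate≡) (nth-++-∷ (c ∷ L) y R)
  y∸s≡ : y ∸ s ≡ c + d
  y∸s≡ = trans (cong (_∸ s) y≡) (m+n∸m≡n s (c + d))
  c≤ : c ≤ nth J (pOf b J) ∸ sOf b J
  c≤ = subst₂ (λ y′ s′ → c ≤ y′ ∸ s′) (sym y′≡) (sym s≡)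
         (subst (c ≤_) (sym y∸s≡) (m≤m+n c d))

≤+⇒0≤-+ : ∀ {A B C} → B ≤ A + C → ⁺ 0 ℤ.≤ (⁺ A ℤ.- ⁺ B) ℤ.+ ⁺ C
≤+⇒0≤-+ {A} {B} {C} B≤A+C = subst (⁺ 0 ℤ.≤_) (sym -+≡+-) (ℤ.i≤j⇒0≤j-i (ℤ.+≤+ B≤A+C))
  where
  -+≡+- : (⁺ A ℤ.- ⁺ B) ℤ.+ ⁺ C ≡ ⁺ (A + C) ℤ.- ⁺ B
  -+≡+- = trans (ℤsolve (⁺ A) (⁺ B) (⁺ C)) (cong (ℤ._- ⁺ B) (sym (ℤ.pos-+ A C)))
    where
    ℤsolve : ∀ X Y Z → (X ℤ.- Y) ℤ.+ Z ≡ (X ℤ.+ Z) ℤ.- Y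
    ℤsolve = ℤ-solve-∀

d+c≤c∸2+s*d : ∀ {c s d} → 2 ≤ c → 3 ≤ s → 1 ≤ d → d + c ≤ (c ∸ 2) + s * d
d+c≤c∸2+s*d {c} {s} {d} 2≤c 3≤s 1≤d = begin
  d + c                ≡⟨ cong (d +_) (m∸n+n≡m 2≤c) ⟨
  d + ((c ∸ 2) + 2)    ≡⟨ x∙yz≈y∙xz d (c ∸ 2) 2 ⟩
  (c ∸ 2) + (d + 2)    ≤⟨ +-monoʳ-≤ (c ∸ 2) (+-monoʳ-≤ d (+-mono-≤ 1≤d (+-monoˡ-≤ 0 1≤d))) ⟩
  (c ∸ 2) + 3 * d      ≤⟨ +-monoʳ-≤ (c ∸ 2) (*-monoˡ-≤ d 3≤s) ⟩
  (c ∸ 2) + s * d      ∎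
  where open ≤-Reasoning

D-nonneg-offsets : ∀ {a b c x s d} M T → 2 ≤ c → 3 ≤ s → 1 ≤ d →
  c + sum M + s ≡ suc b → x ≡ s + (c + d) → a ≡ d + c + sum T →
  ⁺ 0 ℤ.≤ D a b (c ∷ reverse M ++ x ∷ T)
D-nonneg-offsets {a} {b} {c} {x} {s} {d} M T 2≤c 3≤s 1≤d b+1≡ x≡ a≡ = ≤+⇒0≤-+ (begin
  Θ⁻ (reverse (φ a J)) a   ≤⟨ Θ⁻≤ ⟩
  a ∸ sum T                ≡⟨ trans (cong (_∸ sum T) a≡) (m+n∸n≡m (d + c) (sum T)) ⟩
  d + c                    ≤⟨ d+c≤c∸2+s*d 2≤c 3≤s 1≤d ⟩
  (c ∸ 2) + s * d          ≡⟨ cong₂ _+_ (Θ⁺-∷ (reverse M ++ x ∷ T) (s≤s z≤n) 2≤c) Δ≡ ⟨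
  Θ⁺ J 2 + Δ b J           ∎)
  where
  open ≤-Reasoning
  J = c ∷ reverse M ++ x ∷ T
  Δ≡ : Δ b J ≡ s * d
  Δ≡ = Δ-++-∷ (reverse M) T (≤-trans (s≤s z≤n) 3≤s)
         (subst (λ k → c + k + s ≡ suc b) (sym (sum-reverse M)) b+1≡) x≡
  T<a : sum T < a
  T<a = subst (sum T <_) (sym a≡) (m<n+m (sum T) (≤-trans 1≤d (m≤m+n d c)))
  Θ⁻≤ : Θ⁻ (reverse (φ a J)) a ≤ a ∸ sum T
  Θ⁻≤ = subst (λ K → Θ⁻ (reverse (φ a K)) a ≤ a ∸ sum T) (++-assoc (c ∷ reverse M) [ x ] T)
          (Θ⁻-reverse-φ-++ a (c ∷ reverse M ++ [ x ]) T T<a)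

D-nonneg : ∀ {a b} x M c T → 2 ≤ c → sum M + c + 2 ≤ b → 2 + b ≤ x + sum M →
  sum (x ∷ M ++ c ∷ T) ≡ a + b + 1 → ⁺ 0 ℤ.≤ D a b (c ∷ reverse M ++ x ∷ T)
D-nonneg {a} x M c T 2≤c gap overshoot total
  with m≤n⇒∃[o]m+o≡n gap | m≤n⇒∃[o]m+o≡n overshoot
... | e , refl | d , x+M≡ =
  D-nonneg-offsets M T 2≤c (s≤s (s≤s (s≤s z≤n))) (s≤s z≤n) (b+1≡ c (sum M) e) x≡ a≡
  where
  b = sum M + c + 2 + e
  b+1≡ : ∀ c m e → c + m + (3 + e) ≡ suc (m + c + 2 + e)
  b+1≡ = solve-∀
  x≡ : x ≡ 3 + e + (c + suc d)
  x≡ = +-cancelʳ-≡ (sum M) _ _ (trans (sym x+M≡) (x+M≡′ c (sum M) e d))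
    where
    x+M≡′ : ∀ c m e d → 2 + (m + c + 2 + e) + d ≡ 3 + e + (c + suc d) + m
    x+M≡′ = solve-∀
  a≡ : a ≡ suc d + c + sum T
  a≡ = +-cancelʳ-≡ (b + 1) _ _ (begin
    a + (b + 1)                 ≡⟨ +-assoc a b 1 ⟨
    a + b + 1                   ≡⟨ trans (sym total) (sum-∷-++-∷ x M c T) ⟩
    x + sum M + (c + sum T)     ≡⟨ cong (_+ (c + sum T)) x+M≡ ⟨
    2 + b + d + (c + sum T)     ≡⟨ a+b+1≡ b d c (sum T) ⟩
    suc d + c + sum T + (b + 1) ∎)
    where
    open ≡-Reasoning
    a+b+1≡ : ∀ b d c t → 2 + b + d + (c + t) ≡ suc d + c + t + (b + 1)
    a+b+1≡ = solve-∀

0<w : ∀ {J} → All (2 ≤_) J → 0 < w J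
0<w []              = s≤s z≤n
0<w (2≤i ∷ 2≤J) = *-mono-≤ (≤-trans (s≤s z≤n) 2≤i) (0<product 2≤J)
  where
  0<product : ∀ {L} → All (2 ≤_) L → 0 < product (map (λ k → k ∸ 1) L)
  0<product []              = s≤s z≤n
  0<product {suc k ∷ L} (s≤s 1≤k ∷ 2≤L) = *-mono-≤ 1≤k (0<product 2≤L)

In𝒜-suffix : ∀ {a} K S → All (2 ≤_) (K ++ S) → sum S ≡ a → In𝒜 a (K ++ S)
In𝒜-suffix {a} K S 2≤KS S≡a =
  0<w 2≤KS ,
  subst (λ L → Θ⁺ L a ≡ 0) (sym (reverse-++ K S))
        (Θ⁺-++≡0 (reverse S) (reverse K) (trans (sum-reverse S) S≡a))

split-at-p+r : ∀ {b r} x I → 1 ≤ r →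
  pOf b (x ∷ I) + 1 ≤ qOf b (x ∷ I) → r ≤ qOf b (x ∷ I) ∸ pOf b (x ∷ I) →
  ∃[ M ] ∃[ c ] ∃[ T ] (I ≡ M ++ c ∷ T × 2 + length M ≡ pOf b (x ∷ I) + r)
split-at-p+r {b} {r} x I 1≤r p<q r≤q-p =
  let M , c , T , I≡ , M≡n = split-∷ (p + r ∸ 2) I n<I
  in  M , c , T , I≡ , trans (cong (2 +_) M≡n) (m+[n∸m]≡n 2≤p+r)
  where
  p = pOf b (x ∷ I)
  q = qOf b (x ∷ I)
  2≤p+r : 2 ≤ p + r
  2≤p+r = +-mono-≤ (1≤locate₁ (suc b) x I) 1≤r
  p+r≤q : p + r ≤ q
  p+r≤q = subst (_≤ q) (+-comm r p) (m≤o∸n⇒m+n≤o r (≤-trans (m≤m+n p 1) p<q) r≤q-p)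
  q≤ : q ≤ suc (length I)
  q≤ = subst (q ≤_) (trans (length-++ I) (+-comm (length I) 1)) (locate₁≤length (suc b) (I ++ [ x ]))
  n<I : p + r ∸ 2 < length I
  n<I = s≤s⁻¹ (subst (_≤ suc (length I)) (sym (m+[n∸m]≡n 2≤p+r)) (≤-trans p+r≤q q≤))

H-split : ∀ {b r} x M c T → 2 + length M ≡ pOf b (x ∷ M ++ c ∷ T) + r →
  H b r (x ∷ M ++ c ∷ T) ≡ c ∷ reverse M ++ x ∷ T
H-split {b} {r} x M c T 2+M≡p+r = begin
  H b r J                                         ≡⟨ cong (λ k → reverse (take k J) ++ drop k J) 2+M≡p+r ⟨
  reverse (x ∷ take (suc (length M)) (M ++ c ∷ T)) ++ drop (suc (length M)) (M ++ c ∷ T)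
    ≡⟨ cong₂ (λ K R → reverse (x ∷ K) ++ R) (take-++-∷ M c T) (drop-++-∷ M c T) ⟩
  reverse (x ∷ M ++ [ c ]) ++ T                   ≡⟨ cong (_++ T) (reverse-∷-++-∷ʳ x M c) ⟩
  (c ∷ reverse M ++ [ x ]) ++ T                   ≡⟨ cong (c ∷_) (++-assoc (reverse M) [ x ] T) ⟩
  c ∷ reverse M ++ x ∷ T                          ∎
  where
  open ≡-Reasoning
  J = x ∷ M ++ c ∷ T

prefix-sum-lower-bound : ∀ {b r} x M c T → All (2 ≤_) (x ∷ M ++ c ∷ T) →
  suc b ≤ sum (x ∷ M ++ c ∷ T) → 1 ≤ r → 2 + length M ≡ pOf b (x ∷ M ++ c ∷ T) + r →
  suc b + 2 * (r ∸ 1) ≤ x + sum M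
prefix-sum-lower-bound {b} {suc r} x M c T 2≤J b<J _ 2+M≡p+r =
  subst (λ k → suc b + 2 * k ≤ x + sum M) M∸p≡r
        (locate₁≤⇒+2*≤sum (x ∷ M) (c ∷ T) (AllP.++⁻ˡ (x ∷ M) 2≤J) b<J
          (subst (p ≤_) p+r≡ (m≤m+n p r)))
  where
  p = pOf b (x ∷ M ++ c ∷ T)
  p+r≡ : p + r ≡ suc (length M)
  p+r≡ = suc-injective (trans (sym (+-suc p r)) (sym 2+M≡p+r))
  M∸p≡r : suc (length M) ∸ p ≡ r
  M∸p≡r = trans (cong (_∸ p) (sym p+r≡)) (m+n∸m≡n p r)

rotated-prefix-sum-bound : ∀ {b r} x M c T → All (2 ≤_) (x ∷ M ++ c ∷ T) →
  let J = x ∷ M ++ c ∷ T in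
  pOf b J + 1 ≤ qOf b J → 2 + length M ≡ pOf b J + r → r < qOf b J ∸ pOf b J →
  sum M + c + 2 ≤ b
rotated-prefix-sum-bound {b} {r} x M c T (2≤x ∷ 2≤J) p<q 2+M≡p+r r<q-p
  with ++-∷ʳ-uncons T x
... | w , W , T∷x≡ = ≤-pred (begin-strict
  sum M + c + 2             ≤⟨ +-monoʳ-≤ (sum M + c) (≤-trans 2≤w (m≤m+n w 0)) ⟩
  sum M + c + (w + 0)       ≡⟨ +-assoc (sum M) c (w + 0) ⟩
  sum M + (c + (w + 0))     ≡⟨ sum-++ M (c ∷ w ∷ []) ⟨
  sum K                     <⟨ <locate₁⇒sum< K W (s≤s z≤n) K<q ⟩
  suc b                     ∎)
  where
  open ≤-Reasoning
  p = pOf b (x ∷ M ++ c ∷ T)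
  q = qOf b (x ∷ M ++ c ∷ T)
  K = M ++ c ∷ w ∷ []
  rotation≡ : (M ++ c ∷ T) ++ [ x ] ≡ K ++ W
  rotation≡ = trans (++-assoc M (c ∷ T) [ x ])
                (trans (cong (λ L → M ++ c ∷ L) T∷x≡) (sym (++-assoc M (c ∷ w ∷ []) W)))
  2≤w : 2 ≤ w
  2≤w = All.head (subst (All (2 ≤_)) T∷x≡ (AllP.++⁺ (All.tail (AllP.++⁻ʳ M 2≤J)) (2≤x ∷ [])))
  K<q : length K < proj₁ (locate (suc b) (K ++ W))
  K<q = subst (λ L → length K < proj₁ (locate (suc b) L)) rotation≡ (begin-strict
    length K        ≡⟨ length-++ M ⟩
    length M + 2    ≡⟨ trans (+-comm (length M) 2) 2+M≡p+r ⟩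
    p + r           <⟨ subst (_≤ q) (trans (+-comm (suc r) p) (+-suc p r))
                         (m≤o∸n⇒m+n≤o (suc r) (≤-trans (m≤m+n p 1) p<q) r<q-p) ⟩
    q               ∎)

tight⇒In𝒜×r≡1 : ∀ {a b r} x M c T → All (2 ≤_) (x ∷ M ++ c ∷ T) →
  sum (x ∷ M ++ c ∷ T) ≡ a + b + 1 → 1 ≤ r → 2 + length M ≡ pOf b (x ∷ M ++ c ∷ T) + r →
  x + sum M ≤ suc b → In𝒜 a (x ∷ M ++ c ∷ T) × r ≡ 1
tight⇒In𝒜×r≡1 {a} {b} {r} x M c T 2≤J Σ≡ 1≤r 2+M≡p+r tight =
  In𝒜-suffix (x ∷ M) (c ∷ T) 2≤J cT≡a ,
  2*[r∸1]≤0⇒r≡1 r 1≤r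
    (+-cancelˡ-≤ (suc b) _ 0 (≤-trans lower (subst (x + sum M ≤_) (sym (+-identityʳ (suc b))) tight)))
  where
  a+b+1≡ : ∀ a b → a + b + 1 ≡ suc b + a
  a+b+1≡ = solve-∀
  lower : suc b + 2 * (r ∸ 1) ≤ x + sum M
  lower = prefix-sum-lower-bound x M c T 2≤J
            (subst (suc b ≤_) (trans (sym (a+b+1≡ a b)) (sym Σ≡)) (m≤m+n (suc b) a)) 1≤r 2+M≡p+r
  x+M≡ : x + sum M ≡ suc b
  x+M≡ = ≤-antisym tight (≤-trans (m≤m+n (suc b) _) lower)
  cT≡a : c + sum T ≡ a
  cT≡a = +-cancelˡ-≡ (suc b) _ _
    (trans (cong (_+ (c + sum T)) (sym x+M≡))
           (trans (sym (sum-∷-++-∷ x M c T)) (trans Σ≡ (a+b+1≡ a b))))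
  2*[r∸1]≤0⇒r≡1 : ∀ r → 1 ≤ r → 2 * (r ∸ 1) ≤ 0 → r ≡ 1
  2*[r∸1]≤0⇒r≡1 (suc zero)    _ _  = refl
  2*[r∸1]≤0⇒r≡1 (suc (suc r)) _ ()

lemma4p6 : (a b : ℕ) → 2 ≤ b → b ≤ a →
    (I : List ℕ) → In𝒲> (a + b + 1) a I →
    pOf b I + 1 ≤ qOf b I →
    (r : ℕ) → 1 ≤ r → r ≤ qOf b I ∸ pOf b I →
    D a b (H b r I) <ℤ ⁺ 0 →
    r ≡ qOf b I ∸ pOf b I ⊎ (In𝒜 a I × r ≡ 1)
lemma4p6 a b _ _ [] ((_ , Σ≡) , _) _ _ _ _ _ =
  contradiction (sym Σ≡) (m<n⇒n≢0 (m<m+n (a + b) (s≤s z≤n)))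
lemma4p6 a b _ _ (x ∷ I) ((2≤I , Σ≡) , _) p<q r 1≤r r≤q-p D<0
  with split-at-p+r x I 1≤r p<q r≤q-p
... | M , c , T , refl , 2+M≡p+r
  with x + sum M ≤? suc b | m≤n⇒m<n∨m≡n r≤q-p
... | yes tight | _          = inj₂ (tight⇒In𝒜×r≡1 x M c T 2≤I Σ≡ 1≤r 2+M≡p+r tight)
... | no  _     | inj₂ r≡q-p = inj₁ r≡q-p
... | no  loose | inj₁ r<q-p = contradiction D<0 (ℤ.≤⇒≯ 0≤D)
  where
  2≤c : 2 ≤ c
  2≤c = All.head (AllP.++⁻ʳ M (All.tail 2≤I))
  gap : sum M + c + 2 ≤ b
  gap = rotated-prefix-sum-bound x M c T 2≤I p<q 2+M≡p+r r<q-p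
  0≤D : ⁺ 0 ℤ.≤ D a b (H b r (x ∷ M ++ c ∷ T))
  0≤D = subst (λ J → ⁺ 0 ℤ.≤ D a b J) (sym (H-split x M c T 2+M≡p+r))
          (D-nonneg x M c T 2≤c gap (≰⇒> loose) Σ≡)
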